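{- Let $n$ be an odd composite number and let $B:=\{a \in U(\mathbb{Z}_n) \mid a^{\frac{n-1}{2}} \equiv \pm 1 \pmod n\}$. If $|B| \geq \phi(n)/2$, then $n$ is a Carmichael number.
   Context: $U(\mathbb{Z}_n)=\{a\in\mathbb{Z}_n \mid \gcd(a,n)=1\}$ is the group of units modulo $n$, and $\phi$ is Euler's totient function. A Carmichael number is an odd composite number $n$ such that $a^{n-1}\equiv 1 \pmod n$ for every $a\in U(\mathbb{Z}_n)$. -}

module Defs where

open import Data.Nat using (ℕ; suc; _*_; _^_; _∸_; _≤_; NonZero)
open import Data.Nat.DivMod using (_%_; _/_)
open import Data.Nat.GCD using (gcd)
open import Data.Nat.Divisibility using (_∣_)
open import Data.Nat.Primality using (Composite)
open import Data.Nat.Properties using (_≟_)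
open import Data.List using (List; filter; upTo; length)
open import Data.Sum using (_⊎_)
open import Data.Product using (_×_)
open import Relation.Binary.PropositionalEquality using (_≡_)
open import Relation.Nullary using (¬_)
open import Relation.Nullary.Decidable using (_⊎-dec_)

-- U(ℤ_n), with ℤ_n represented by the residues 0,…,n-1
units : ℕ → List ℕ
units n = filter (λ a → gcd a n ≟ 1) (upTo n)

φ : ℕ → ℕ
φ n = length (units n)

-- B = { a ∈ U(ℤ_n) | a^((n-1)/2) ≡ ±1 (mod n) }
--   (−1 mod n is the residue n ∸ 1)
B : (n : ℕ) → .{{NonZero n}} → List ℕ
B n = filter (λ a → ((a ^ ((n ∸ 1) / 2)) % n ≟ 1 % n)
                    ⊎-dec ((a ^ ((n ∸ 1) / 2)) % n ≟ n ∸ 1))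
             (units n)

IsCarmichael : (n : ℕ) → .{{NonZero n}} → Set
IsCarmichael n = (¬ (2 ∣ n)) × Composite n
  × (∀ a → a Data.List.Membership.Propositional.∈ units n → (a ^ (n ∸ 1)) % n ≡ 1 % n)
  where import Data.List.Membership.Propositional

module Submission where

-- Let e = (n-1)/2, so n - 1 = e + e since n is odd.  A unit a has a^(n-1) = (a^e)² ≡ 1 if a ∈ B, and
--       a^(n-1) ≡ (a² mod n)^e ≡ ±1 if a² mod n ∈ B.  If neither held, then
--       x ↦ a·x mod n would inject a ∷ B into the units outside B (a·x ∈ B
--       with x ∈ B would force a ∈ B, since ±1 is closed under quotients), so
--       |B| + 1 ≤ φ(n) - |B|, against φ(n) ≤ 2|B|.  Hence a^(n-1) ≡ ±1 (mod n)
--       for every unit a.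
--   (2) Excluding -1.  If x^(n-1) ≡ -1 (mod n), write n - 1 = 2^v·m with m odd
--       and y = x^m.  For every prime p ∣ n, y has order 2^(v+1) modulo p, which
--       divides p - 1 by Fermat's little theorem; so every prime factor of n,
--       and hence n itself, is ≡ 1 (mod 2^(v+1)), contradicting m odd.

open import Defs
open import Level using (0ℓ)
open import Algebra.Bundles using (CommutativeSemiring)
open import Data.Nat
open import Data.Nat.Properties
open import Data.Nat.Divisibility
open import Data.Nat.DivMod using (_%_; _/_; m%n<n; m<n⇒m%n≡m; m≡m%n+[m/n]*n; %-remove-+ʳ)
open import Data.Nat.Combinatorics using (_C_; nC1≡n; nCn≡1; nCk+nC[k+1]≡[n+1]C[k+1])
open import Data.Nat.Coprimality using (Coprime; coprime-divisor; gcd≡1⇒coprime; coprime⇒gcd≡1)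
import Data.Nat.Coprimality as Coprime
open import Data.Nat.GCD using (gcd; gcd-GCD; gcd[m,n]∣m; gcd[m,n]∣n; module Bézout)
open import Data.Nat.Induction using (<-rec)
open import Data.Nat.ListAction using (product)
open import Data.Nat.ListAction.Properties using (∈⇒∣product)
open import Data.Nat.Primality
open import Data.Nat.Primality.Factorisation using (factorise; PrimeFactorisation)
open import Data.Nat.Tactic.RingSolver using (solve; solve-∀)
open import Data.Fin.Base using (zero; suc; toℕ; inject₁; fromℕ)
open import Data.Fin.Properties using (toℕ<n; toℕ-fromℕ; toℕ-inject₁)
open import Data.Vec.Functional using (tail; init; last)
open import Data.List using (List; []; _∷_; _++_; filter; length)
open import Data.List.Properties using (length-++-sucʳ)
open import Data.List.Membership.Propositional using (_∈_)
open import Data.List.Membership.Propositional.Properties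
  using (∈-filter⁺; ∈-filter⁻; ∈-upTo⁺; ∈-upTo⁻; ∈-∃++; ∈-++⁻; ∈-++⁺ˡ; ∈-++⁺ʳ)
open import Data.List.Relation.Unary.Any using (here; there)
import Data.List.Relation.Unary.All as All
open import Data.List.Relation.Unary.AllPairs using (_∷_)
open import Data.List.Relation.Unary.Unique.Propositional using (Unique)
import Data.List.Relation.Unary.Unique.Propositional.Properties as Unique
open import Data.Product using (∃₂; _×_; _,_; proj₁; proj₂)
open import Data.Sum using (_⊎_; inj₁; inj₂)
open import Data.Empty using (⊥-elim)
open import Function using (_∘_)
open import Relation.Nullary using (¬_; yes; no)
open import Relation.Nullary.Decidable using (¬?; _⊎-dec_)
open import Relation.Unary using (Decidable)
open import Relation.Binary.Bundles using (Setoid)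
open import Relation.Binary.Structures using (IsEquivalence)
open import Relation.Binary.PropositionalEquality
import Relation.Binary.Reasoning.Setoid as SetoidReasoning

infix 4 _≡_mod_

-- a ≡ b (mod n), witnessed by multiples of n added to both sides: this
-- avoids truncated subtraction and makes sense for every modulus n.
_≡_mod_ : ℕ → ℕ → ℕ → Set
a ≡ b mod n = ∃₂ λ k l → a + k * n ≡ b + l * n

module _ {n : ℕ} where
  open ≡-Reasoning

  ≡⇒≡mod : ∀ {a b} → a ≡ b → a ≡ b mod n
  ≡⇒≡mod refl = 0 , 0 , refl

  mod-refl : ∀ {a} → a ≡ a mod n
  mod-refl = ≡⇒≡mod refl

  mod-sym : ∀ {a b} → a ≡ b mod n → b ≡ a mod n
  mod-sym (k , l , e) = l , k , sym e

  mod-trans : ∀ {a b c} → a ≡ b mod n → b ≡ c mod n → a ≡ c mod n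
  mod-trans {a} {b} {c} (k , l , e) (k′ , l′ , e′) = k + k′ , l′ + l , (begin
    a + (k + k′) * n      ≡⟨ solve (a ∷ k ∷ k′ ∷ n ∷ []) ⟩
    (a + k * n) + k′ * n  ≡⟨ cong (_+ k′ * n) e ⟩
    (b + l * n) + k′ * n  ≡⟨ solve (b ∷ l ∷ k′ ∷ n ∷ []) ⟩
    (b + k′ * n) + l * n  ≡⟨ cong (_+ l * n) e′ ⟩
    (c + l′ * n) + l * n  ≡⟨ solve (c ∷ l ∷ l′ ∷ n ∷ []) ⟩
    c + (l′ + l) * n      ∎)

  mod-isEquivalence : IsEquivalence (λ a b → a ≡ b mod n)
  mod-isEquivalence = record { refl = mod-refl ; sym = mod-sym ; trans = mod-trans }

  mod-+ : ∀ {a b c d} → a ≡ b mod n → c ≡ d mod n → a + c ≡ b + d mod n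
  mod-+ {a} {b} {c} {d} (k , l , e) (k′ , l′ , e′) = k + k′ , l + l′ , (begin
    a + c + (k + k′) * n        ≡⟨ solve (a ∷ c ∷ k ∷ k′ ∷ n ∷ []) ⟩
    (a + k * n) + (c + k′ * n)  ≡⟨ cong₂ _+_ e e′ ⟩
    (b + l * n) + (d + l′ * n)  ≡⟨ solve (b ∷ d ∷ l ∷ l′ ∷ n ∷ []) ⟩
    b + d + (l + l′) * n        ∎)

  mod-* : ∀ {a b c d} → a ≡ b mod n → c ≡ d mod n → a * c ≡ b * d mod n
  mod-* {a} {b} {c} {d} (k , l , e) (k′ , l′ , e′) =
    a * k′ + k * c + k * k′ * n , b * l′ + l * d + l * l′ * n , (begin
    a * c + (a * k′ + k * c + k * k′ * n) * n  ≡⟨ solve (a ∷ c ∷ k ∷ k′ ∷ n ∷ []) ⟩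
    (a + k * n) * (c + k′ * n)                 ≡⟨ cong₂ _*_ e e′ ⟩
    (b + l * n) * (d + l′ * n)                 ≡⟨ solve (b ∷ d ∷ l ∷ l′ ∷ n ∷ []) ⟩
    b * d + (b * l′ + l * d + l * l′ * n) * n  ∎)

  mod-^ : ∀ {a b} m → a ≡ b mod n → a ^ m ≡ b ^ m mod n
  mod-^ zero    _   = mod-refl
  mod-^ (suc m) a≡b = mod-* a≡b (mod-^ m a≡b)

  mod-cancelʳ-+ : ∀ {a b} c → a + c ≡ b + c mod n → a ≡ b mod n
  mod-cancelʳ-+ {a} {b} c (k , l , e) = k , l , +-cancelʳ-≡ c _ _ (begin
    a + k * n + c  ≡⟨ solve (a ∷ k ∷ n ∷ c ∷ []) ⟩
    a + c + k * n  ≡⟨ e ⟩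
    b + c + l * n  ≡⟨ solve (b ∷ c ∷ l ∷ n ∷ []) ⟩
    b + l * n + c  ∎)

  ∣⇒≡0mod : ∀ {a} → n ∣ a → a ≡ 0 mod n
  ∣⇒≡0mod (divides q refl) = 0 , q , +-identityʳ _

  ≡0mod⇒∣ : ∀ {a} → a ≡ 0 mod n → n ∣ a
  ≡0mod⇒∣ {a} (k , l , e) = ∣m+n∣m⇒∣n (divides l (trans (+-comm (k * n) a) e)) (n∣m*n k)

  mod⇒∣dist : ∀ {a b} → a ≡ b mod n → n ∣ ∣ a - b ∣
  mod⇒∣dist {a} {b} (k , l , e) = divides ∣ l - k ∣ (begin
    ∣ a - b ∣                  ≡⟨ ∣m+n-m+o∣≡∣n-o∣ (k * n) a b ⟨
    ∣ k * n + a - k * n + b ∣  ≡⟨ cong₂ ∣_-_∣ (+-comm (k * n) a) (+-comm (k * n) b) ⟩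
    ∣ a + k * n - b + k * n ∣  ≡⟨ cong (λ z → ∣ z - b + k * n ∣) e ⟩
    ∣ b + l * n - b + k * n ∣  ≡⟨ ∣m+n-m+o∣≡∣n-o∣ b (l * n) (k * n) ⟩
    ∣ l * n - k * n ∣          ≡⟨ *-distribʳ-∣-∣ n l k ⟨
    ∣ l - k ∣ * n              ∎)

  ∣dist⇒mod : ∀ {a b} → n ∣ ∣ a - b ∣ → a ≡ b mod n
  ∣dist⇒mod {a} {b} n∣d with ≤-total a b
  ... | inj₁ a≤b with divides q e ← subst (n ∣_) (m≤n⇒∣m-n∣≡n∸m a≤b) n∣d =
    q , 0 , trans (cong (a +_) (sym e)) (trans (m+[n∸m]≡n a≤b) (sym (+-identityʳ b)))
  ... | inj₂ b≤a with divides q e ← subst (n ∣_) (m≤n⇒∣n-m∣≡n∸m b≤a) n∣d =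
    0 , q , trans (+-identityʳ a) (trans (sym (m+[n∸m]≡n b≤a)) (cong (b +_) e))

  mod-cancelˡ-* : ∀ {x a b} → Coprime n x → x * a ≡ x * b mod n → a ≡ b mod n
  mod-cancelˡ-* {x} {a} {b} cop xa≡xb = ∣dist⇒mod (coprime-divisor cop
    (subst (n ∣_) (sym (*-distribˡ-∣-∣ x a b)) (mod⇒∣dist xa≡xb)))

  mod-∣ : ∀ {d a b} → d ∣ n → a ≡ b mod n → a ≡ b mod d
  mod-∣ {d} {a} {b} (divides q refl) (k , l , e) = k * q , l * q ,
    trans (cong (a +_) (*-assoc k q d)) (trans e (cong (b +_) (sym (*-assoc l q d))))

module _ {n : ℕ} .{{_ : NonZero n}} where
  open ≡-Reasoning

  mod-% : ∀ a → a ≡ a % n mod n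
  mod-% a = 0 , a / n , trans (+-identityʳ a) (m≡m%n+[m/n]*n a n)

  mod⇒%≡ : ∀ {a b} → a ≡ b mod n → a % n ≡ b % n
  mod⇒%≡ {a} {b} (k , l , e) = begin
    a % n            ≡⟨ %-remove-+ʳ a (n∣m*n k) ⟨
    (a + k * n) % n  ≡⟨ cong (_% n) e ⟩
    (b + l * n) % n  ≡⟨ %-remove-+ʳ b (n∣m*n l) ⟩
    b % n            ∎

  %≡⇒mod : ∀ {a b} → a % n ≡ b % n → a ≡ b mod n
  %≡⇒mod {a} {b} e = mod-trans (mod-% a) (subst (_≡ b mod n) (sym e) (mod-sym (mod-% b)))

modSetoid : ℕ → Setoid 0ℓ 0ℓ
modSetoid n = record { isEquivalence = mod-isEquivalence {n} }

ℕ/ : ℕ → CommutativeSemiring 0ℓ 0ℓ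
ℕ/ n = record
  { Carrier = ℕ ; _≈_ = λ a b → a ≡ b mod n ; _+_ = _+_ ; _*_ = _*_ ; 0# = 0 ; 1# = 1
  ; isCommutativeSemiring = record
    { isSemiring = record
      { isSemiringWithoutAnnihilatingZero = record
        { +-isCommutativeMonoid = record
          { isMonoid = record
            { isSemigroup = record
              { isMagma = record { isEquivalence = mod-isEquivalence ; ∙-cong = mod-+ }
              ; assoc = λ a b c → ≡⇒≡mod (+-assoc a b c) }
            ; identity = (λ a → ≡⇒≡mod (+-identityˡ a)) , (λ a → ≡⇒≡mod (+-identityʳ a)) }
          ; comm = λ a b → ≡⇒≡mod (+-comm a b) }
        ; *-cong = mod-*
        ; *-assoc = λ a b c → ≡⇒≡mod (*-assoc a b c)
        ; *-identity = (λ a → ≡⇒≡mod (*-identityˡ a)) , (λ a → ≡⇒≡mod (*-identityʳ a))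
        ; distrib = (λ a b c → ≡⇒≡mod (*-distribˡ-+ a b c)) , (λ a b c → ≡⇒≡mod (*-distribʳ-+ a b c)) }
      ; zero = (λ a → ≡⇒≡mod (*-zeroˡ a)) , (λ a → ≡⇒≡mod (*-zeroʳ a)) }
    ; *-comm = λ a b → ≡⇒≡mod (*-comm a b) } }

absorption : ∀ n k → suc k * (suc n C suc k) ≡ suc n * (n C k)
absorption zero    zero    = refl
absorption zero    (suc k) = *-zeroʳ (suc (suc k))
absorption (suc n) zero    = trans (+-identityʳ _) (trans (nC1≡n (suc (suc n))) (sym (*-identityʳ _)))
absorption (suc n) (suc k) = begin
  suc (suc k) * (suc (suc n) C suc (suc k))  ≡⟨ cong (suc (suc k) *_) (nCk+nC[k+1]≡[n+1]C[k+1] (suc n) (suc k)) ⟨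
  suc (suc k) * (Z + W)                      ≡⟨ distribute k Z W ⟩
  suc k * Z + Z + suc (suc k) * W            ≡⟨ cong₂ (λ u v → u + Z + v) (absorption n k) (absorption n (suc k)) ⟩
  suc n * X + Z + suc n * Y                  ≡⟨ collect n X Y Z ⟩
  suc n * (X + Y) + Z                        ≡⟨ cong (λ u → suc n * u + Z) (nCk+nC[k+1]≡[n+1]C[k+1] n k) ⟩
  suc n * Z + Z                              ≡⟨ +-comm (suc n * Z) Z ⟩
  suc (suc n) * Z                            ∎
  where
  open ≡-Reasoning
  X = n C k
  Y = n C suc k
  Z = suc n C suc k
  W = suc n C suc (suc k)
  distribute : ∀ k Z W → suc (suc k) * (Z + W) ≡ suc k * Z + Z + suc (suc k) * W
  distribute = solve-∀
  collect : ∀ n X Y Z → suc n * X + Z + suc n * Y ≡ suc n * (X + Y) + Z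
  collect = solve-∀

prime∣C : ∀ {p k} → Prime p → 0 < k → k < p → p ∣ p C k
prime∣C {suc n} {suc k} p-prime _ k<p
  with euclidsLemma (suc k) (suc n C suc k) p-prime
         (divides (n C k) (trans (absorption n k) (*-comm (suc n) (n C k))))
... | inj₁ p∣k+1 = ⊥-elim (<⇒≱ k<p (∣⇒≤ p∣k+1))
... | inj₂ p∣C   = p∣C

-- Freshman's dream: (x + y)^p ≡ x^p + y^p (mod p) for a prime p = m + 1.
-- It is the binomial theorem in the semiring ℕ/p, whose inner terms vanish.
module FreshmansDream {m : ℕ} (p-prime : Prime (suc m)) where
  private
    p = suc m
    module S = CommutativeSemiring (ℕ/ p)
  open import Algebra.Properties.Semiring.Mult S.semiring using () renaming (_×_ to _×ₛ_)
  open import Algebra.Properties.Semiring.Exp S.semiring using () renaming (_^_ to _^ₛ_)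
  open import Algebra.Properties.Semiring.Sum S.semiring
    using (sum; sum-cong-≋; sum-init-last; sum-replicate-zero)
  open import Algebra.Properties.CommutativeSemiring.Binomial (ℕ/ p) using (theorem; binomialTerm)

  ×ₛ≡* : ∀ k z → k ×ₛ z ≡ k * z
  ×ₛ≡* zero    z = refl
  ×ₛ≡* (suc k) z = cong (z +_) (×ₛ≡* k z)

  ^ₛ≡^ : ∀ z k → z ^ₛ k ≡ z ^ k
  ^ₛ≡^ z zero    = refl
  ^ₛ≡^ z (suc k) = cong (z *_) (^ₛ≡^ z k)

  term : ℕ → ℕ → ℕ → ℕ
  term x y k = (p C k) * (x ^ k * y ^ (p ∸ k))

  binomialTerm≡term : ∀ x y k → binomialTerm x y p k ≡ term x y (toℕ k)
  binomialTerm≡term x y k = trans (×ₛ≡* (p C toℕ k) _)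
    (cong₂ (λ u v → (p C toℕ k) * (u * v)) (^ₛ≡^ x (toℕ k)) (^ₛ≡^ y (p ∸ toℕ k)))

  first-term : ∀ x y → term x y 0 ≡ y ^ p
  first-term x y = trans (*-identityˡ _) (*-identityˡ _)

  last-term : ∀ x y → term x y p ≡ x ^ p
  last-term x y = begin
    (p C p) * (x ^ p * y ^ (p ∸ p))  ≡⟨ cong₂ (λ c e → c * (x ^ p * y ^ e)) (nCn≡1 p) (n∸n≡0 p) ⟩
    1 * (x ^ p * 1)                  ≡⟨ *-identityˡ _ ⟩
    x ^ p * 1                        ≡⟨ *-identityʳ _ ⟩
    x ^ p                            ∎
    where open ≡-Reasoning

  inner-term : ∀ x y k → 0 < k → k < p → term x y k ≡ 0 mod p
  inner-term x y k 0<k k<p = ∣⇒≡0mod (∣-trans (prime∣C p-prime 0<k k<p) (m∣m*n _))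

  freshman : ∀ x y → (x + y) ^ p ≡ x ^ p + y ^ p mod p
  freshman x y = begin
    (x + y) ^ p                                     ≡⟨ ^ₛ≡^ (x + y) p ⟨
    (x + y) ^ₛ p                                    ≈⟨ theorem p x y ⟩
    t zero + sum (tail t)                           ≈⟨ mod-+ (mod-refl {a = t zero}) (sum-init-last (tail t)) ⟩
    t zero + (sum (init (tail t)) + last (tail t))  ≈⟨ mod-+ (mod-refl {a = t zero})
                                                         (mod-+ inner-sum (mod-refl {a = last (tail t)})) ⟩
    t zero + (0 + last (tail t))                    ≡⟨ cong₂ _+_ t₀ tₚ ⟩
    y ^ p + x ^ p                                   ≡⟨ +-comm (y ^ p) (x ^ p) ⟩
    x ^ p + y ^ p                                   ∎
    where
    open SetoidReasoning S.setoid
    t = binomialTerm x y p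
    t₀ : t zero ≡ y ^ p
    t₀ = trans (binomialTerm≡term x y zero) (first-term x y)
    tₚ : last (tail t) ≡ x ^ p
    tₚ = trans (binomialTerm≡term x y (fromℕ p)) (trans (cong (term x y) (toℕ-fromℕ p)) (last-term x y))
    inner : ∀ i → init (tail t) i ≡ 0 mod p
    inner i = subst (_≡ 0 mod p) (sym (binomialTerm≡term x y (suc (inject₁ i))))
      (inner-term x y _ (s≤s z≤n) (s≤s (subst (_< m) (sym (toℕ-inject₁ i)) (toℕ<n i))))
    inner-sum : sum (init (tail t)) ≡ 0 mod p
    inner-sum = S.trans (sum-cong-≋ inner) (sum-replicate-zero m)

¬∣⇒coprime : ∀ {p a} → Prime p → ¬ p ∣ a → Coprime p a
¬∣⇒coprime p-prime p∤a (d∣p , d∣a) with prime⇒irreducible p-prime d∣p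
... | inj₁ d≡1 = d≡1
... | inj₂ refl = ⊥-elim (p∤a d∣a)

-- Fermat's little theorem: a^p ≡ a (mod p), by induction on a using (1 + a)^p ≡ 1 + a^p.
fermat : ∀ {p} a → Prime p → a ^ p ≡ a mod p
fermat {suc m} zero    _       = mod-refl
fermat {suc m} (suc a) p-prime = mod-trans (FreshmansDream.freshman p-prime 1 a)
  (mod-+ (≡⇒≡mod (^-zeroˡ (suc m))) (fermat a p-prime))

fermat-unit : ∀ {p} a → Prime p → ¬ p ∣ a → a ^ (p ∸ 1) ≡ 1 mod p
fermat-unit {suc m} a p-prime p∤a = mod-cancelˡ-* (¬∣⇒coprime p-prime p∤a)
  (subst (a ^ suc m ≡_mod suc m) (sym (*-identityʳ a)) (fermat a p-prime))

-1*-1≡1 : ∀ {n y z} → y + 1 ≡ 0 mod n → z + 1 ≡ 0 mod n → y * z ≡ 1 mod n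
-1*-1≡1 {n} {y} {z} y≡-1 z≡-1 = mod-cancelʳ-+ (y + 1 + (z + 1)) (begin
  y * z + (y + 1 + (z + 1))  ≡⟨ expand y z ⟩
  (y + 1) * (z + 1) + 1      ≈⟨ mod-+ (mod-* y≡-1 z≡-1) (mod-refl {a = 1}) ⟩
  1                          ≈⟨ mod-+ (mod-refl {a = 1}) (mod-+ y≡-1 z≡-1) ⟨
  1 + (y + 1 + (z + 1))      ∎)
  where
  open SetoidReasoning (modSetoid n)
  expand : ∀ y z → y * z + (y + 1 + (z + 1)) ≡ (y + 1) * (z + 1) + 1
  expand = solve-∀

^-*≡1 : ∀ {n y a} i → y ^ a ≡ 1 mod n → y ^ (i * a) ≡ 1 mod n
^-*≡1 {n} {y} {a} i y^a≡1 = subst (_≡ 1 mod n)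
  (trans (^-*-assoc y a i) (cong (y ^_) (*-comm a i)))
  (subst ((y ^ a) ^ i ≡_mod n) (^-zeroˡ i) (mod-^ i y^a≡1))

^-∸≡1 : ∀ {n y d e} → y ^ e ≡ 1 mod n → y ^ (d + e) ≡ 1 mod n → y ^ d ≡ 1 mod n
^-∸≡1 {n} {y} {d} {e} y^e≡1 y^d+e≡1 = begin
  y ^ d            ≡⟨ *-identityʳ (y ^ d) ⟨
  y ^ d * 1        ≈⟨ mod-* (mod-refl {a = y ^ d}) y^e≡1 ⟨
  y ^ d * y ^ e    ≡⟨ ^-distribˡ-+-* y d e ⟨
  y ^ (d + e)      ≈⟨ y^d+e≡1 ⟩
  1                ∎
  where open SetoidReasoning (modSetoid n)

^-gcd≡1 : ∀ {n y a b} → y ^ a ≡ 1 mod n → y ^ b ≡ 1 mod n → y ^ gcd a b ≡ 1 mod n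
^-gcd≡1 {n} {y} {a} {b} y^a≡1 y^b≡1 with Bézout.identity (gcd-GCD a b)
... | Bézout.+- i j eq = ^-∸≡1 {d = gcd a b} {e = j * b} (^-*≡1 {a = b} j y^b≡1)
  (subst (λ e → y ^ e ≡ 1 mod n) (sym eq) (^-*≡1 {a = a} i y^a≡1))
... | Bézout.-+ i j eq = ^-∸≡1 {d = gcd a b} {e = i * a} (^-*≡1 {a = a} i y^a≡1)
  (subst (λ e → y ^ e ≡ 1 mod n) (sym eq) (^-*≡1 {a = b} j y^b≡1))

∣p^[1+k] : ∀ {p} k {d} → Prime p → d ∣ p ^ suc k → d ≡ p ^ suc k ⊎ d ∣ p ^ k
∣p^[1+k] {p} k {d} p-prime d∣ with p ∣? d
... | no p∤d = inj₂ (coprime-divisor (Coprime.sym (¬∣⇒coprime p-prime p∤d)) d∣)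
... | yes (divides d′ refl)
  with *-cancelʳ-∣ {d′} {p ^ k} p {{prime⇒nonZero p-prime}} (subst (d′ * p ∣_) (*-comm p (p ^ k)) d∣)
∣p^[1+k] {p} zero p-prime _ | yes (divides d′ refl) | d′∣1 =
  inj₁ (trans (cong (_* p) (∣1⇒≡1 d′∣1)) (*-comm 1 p))
∣p^[1+k] {p} (suc k) p-prime _ | yes (divides d′ refl) | d′∣p^[1+k]
  with ∣p^[1+k] k p-prime d′∣p^[1+k]
... | inj₁ refl = inj₁ (*-comm (p ^ suc k) p)
... | inj₂ d′∣p^k = inj₂ (subst (d′ * p ∣_) (*-comm (p ^ k) p) (*-monoˡ-∣ p d′∣p^k))

∣∸1⇒≡1 : ∀ {q p} → 1 ≤ p → q ∣ p ∸ 1 → p ≡ 1 mod q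
∣∸1⇒≡1 {q} {p} 1≤p q∣p-1 = subst (_≡ 1 mod q) (m+[n∸m]≡n 1≤p)
  (mod-+ (mod-refl {a = 1}) (∣⇒≡0mod q∣p-1))

≡1⇒∣∸1 : ∀ {q p} → 1 ≤ p → p ≡ 1 mod q → q ∣ p ∸ 1
≡1⇒∣∸1 {q} {p} 1≤p p≡1 = ≡0mod⇒∣ (mod-cancelʳ-+ 1
  (subst (_≡ 1 mod q) (trans (sym (m+[n∸m]≡n 1≤p)) (+-comm 1 (p ∸ 1))) p≡1))

product≡1 : ∀ {q} ps → (∀ {p} → p ∈ ps → p ≡ 1 mod q) → product ps ≡ 1 mod q
product≡1 []       _   = mod-refl
product≡1 (p ∷ ps) ps≡1 = mod-* (ps≡1 (here refl)) (product≡1 ps (ps≡1 ∘ there))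

2-adic : ∀ N → 0 < N → ∃₂ λ v m → N ≡ 2 ^ v * m × ¬ 2 ∣ m
2-adic = <-rec _ decompose
  where
  decompose : ∀ N → (∀ {M} → M < N → 0 < M → ∃₂ λ v m → M ≡ 2 ^ v * m × ¬ 2 ∣ m) →
              0 < N → ∃₂ λ v m → N ≡ 2 ^ v * m × ¬ 2 ∣ m
  decompose N rec 0<N with 2 ∣? N
  ... | no 2∤N = 0 , N , sym (+-identityʳ N) , 2∤N
  ... | yes (divides q refl) with rec (m<m*n q 2 {{>-nonZero 0<q}} (s≤s (s≤s z≤n))) 0<q
    where 0<q = n≢0⇒n>0 λ { refl → <⇒≢ 0<N refl }
  ... | v , m , refl , 2∤m = suc v , m , trans (*-comm (2 ^ v * m) 2) (sym (*-assoc 2 (2 ^ v) m)) , 2∤m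

prime-factors≡1 : ∀ {n q} .{{_ : NonZero n}} →
  (∀ {p} → Prime p → p ∣ n → p ≡ 1 mod q) → n ≡ 1 mod q
prime-factors≡1 {n} {q} factor≡1 = subst (_≡ 1 mod q) (sym isFactorisation)
  (product≡1 factors λ p∈ps → factor≡1 (All.lookup factorsPrime p∈ps)
    (subst (_ ∣_) (sym isFactorisation) (∈⇒∣product p∈ps)))
  where open PrimeFactorisation (factorise n)

1≢-1 : ∀ {p y} → Prime p → p ≢ 2 → y ≡ 1 mod p → ¬ (y + 1 ≡ 0 mod p)
1≢-1 {p} p-prime p≢2 y≡1 y≡-1
  with irreducible[2] (≡0mod⇒∣ (mod-trans (mod-sym (mod-+ y≡1 (mod-refl {a = 1}))) y≡-1))
... | inj₁ refl = ¬prime[1] p-prime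
... | inj₂ p≡2  = p≢2 p≡2

∣⇒^≢-1 : ∀ {p y k} → 0 < k → Prime p → p ∣ y → ¬ (y ^ k + 1 ≡ 0 mod p)
∣⇒^≢-1 {p} {y} {suc k} _ p-prime p∣y y^k≡-1 = ¬prime[1] (subst Prime (∣1⇒≡1 p∣1) p-prime)
  where
  p∣1 : p ∣ 1
  p∣1 = ≡0mod⇒∣ (mod-trans (mod-sym (mod-+ (∣⇒≡0mod (∣-trans p∣y (m∣m*n (y ^ k)))) (mod-refl {a = 1}))) y^k≡-1)

-- If y^(2^v) ≡ -1 modulo a prime p ≠ 2, then y has order 2^(v+1) modulo p,
-- which divides p - 1 by Fermat's little theorem: p ≡ 1 (mod 2^(v+1)).
odd-prime≡1 : ∀ {p y} v → Prime p → p ≢ 2 → y ^ (2 ^ v) + 1 ≡ 0 mod p → p ≡ 1 mod 2 ^ suc v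
odd-prime≡1 {p} {y} v p-prime p≢2 y^2^v≡-1
  with ∣p^[1+k] v prime[2] (gcd[m,n]∣m (2 ^ suc v) (p ∸ 1))
... | inj₁ g≡2^[1+v] = ∣∸1⇒≡1 (<⇒≤ (nonTrivial⇒n>1 p {{prime⇒nonTrivial p-prime}}))
  (subst (_∣ p ∸ 1) g≡2^[1+v] (gcd[m,n]∣n (2 ^ suc v) (p ∸ 1)))
... | inj₂ (divides c 2^v≡c*g) = ⊥-elim (1≢-1 p-prime p≢2 y^2^v≡1 y^2^v≡-1)
  where
  p∤y : ¬ p ∣ y
  p∤y p∣y = ∣⇒^≢-1 (m^n>0 2 v) p-prime p∣y y^2^v≡-1
  y^2^[1+v]≡1 : y ^ (2 ^ suc v) ≡ 1 mod p
  y^2^[1+v]≡1 = subst (_≡ 1 mod p)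
    (sym (trans (^-distribˡ-+-* y (2 ^ v) (2 ^ v + 0)) (cong (λ e → y ^ (2 ^ v) * y ^ e) (+-identityʳ (2 ^ v)))))
    (-1*-1≡1 y^2^v≡-1 y^2^v≡-1)
  y^2^v≡1 : y ^ (2 ^ v) ≡ 1 mod p
  y^2^v≡1 = subst (λ e → y ^ e ≡ 1 mod p) (sym 2^v≡c*g)
    (^-*≡1 c (^-gcd≡1 {a = 2 ^ suc v} {b = p ∸ 1} y^2^[1+v]≡1 (fermat-unit y p-prime p∤y)))

-- Writing n - 1 = 2^v·m
-- with m odd, every prime factor of n is ≡ 1 (mod 2^(v+1)) by odd-prime≡1
-- applied to y = x^m; hence so is n, i.e. 2^(v+1) ∣ 2^v·m, contradicting m odd.
no-minus-one : ∀ {n} x → 1 < n → ¬ 2 ∣ n → ¬ (x ^ (n ∸ 1) + 1 ≡ 0 mod n)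
no-minus-one {n} x 1<n 2∤n x^[n-1]≡-1 with 2-adic (n ∸ 1) (m<n⇒0<n∸m 1<n)
... | v , m , n-1≡2^v*m , 2∤m = 2∤m (*-cancelˡ-∣ (2 ^ v) {{m^n≢0 2 v}} 2^v*2∣2^v*m)
  where
  y^2^v≡-1 : (x ^ m) ^ (2 ^ v) + 1 ≡ 0 mod n
  y^2^v≡-1 = subst (λ z → z + 1 ≡ 0 mod n)
    (trans (cong (x ^_) (trans n-1≡2^v*m (*-comm (2 ^ v) m))) (sym (^-*-assoc x m (2 ^ v))))
    x^[n-1]≡-1
  n≡1 : n ≡ 1 mod 2 ^ suc v
  n≡1 = prime-factors≡1 {{>-nonZero (<-trans z<s 1<n)}} λ p-prime p∣n →
    odd-prime≡1 v p-prime (λ { refl → 2∤n p∣n }) (mod-∣ p∣n y^2^v≡-1)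
  2^v*2∣2^v*m : 2 ^ v * 2 ∣ 2 ^ v * m
  2^v*2∣2^v*m = subst₂ _∣_ (*-comm 2 (2 ^ v)) n-1≡2^v*m (≡1⇒∣∸1 (<⇒≤ 1<n) n≡1)

length-filter-split : ∀ {A : Set} {P : A → Set} (P? : Decidable P) (xs : List A) →
  length (filter P? xs) + length (filter (¬? ∘ P?) xs) ≡ length xs
length-filter-split P? [] = refl
length-filter-split P? (x ∷ xs) with P? x
... | yes _ = cong suc (length-filter-split P? xs)
... | no  _ = trans (+-suc _ _) (cong suc (length-filter-split P? xs))

injection⇒length≤ : ∀ {A B : Set} (f : A → B) (xs : List A) (ys : List B) → Unique xs →
  (∀ {x} → x ∈ xs → f x ∈ ys) → (∀ {x y} → x ∈ xs → y ∈ xs → f x ≡ f y → x ≡ y) →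
  length xs ≤ length ys
injection⇒length≤ f []       ys _              _    _   = z≤n
injection⇒length≤ f (x ∷ xs) ys (x∉xs ∷ uniq) into inj with ∈-∃++ (into (here refl))
... | us , vs , refl = subst (suc (length xs) ≤_) (sym (length-++-sucʳ us (f x) vs))
  (s≤s (injection⇒length≤ f xs (us ++ vs) uniq into′ (λ x∈ y∈ → inj (there x∈) (there y∈))))
  where
  into′ : ∀ {y} → y ∈ xs → f y ∈ us ++ vs
  into′ {y} y∈xs with ∈-++⁻ us (into (there y∈xs))
  ... | inj₁ fy∈us          = ∈-++⁺ˡ fy∈us
  ... | inj₂ (here fy≡fx)   = ⊥-elim (All.lookup x∉xs y∈xs (inj (here refl) (there y∈xs) (sym fy≡fx)))
  ... | inj₂ (there fy∈vs)  = ∈-++⁺ʳ us fy∈vs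

infix 4 _≡±1mod_

_≡±1mod_ : ℕ → ℕ → Set
y ≡±1mod n = y ≡ 1 mod n ⊎ y + 1 ≡ 0 mod n

module _ {n : ℕ} where

  ±1-* : ∀ {y z} → y ≡±1mod n → z ≡±1mod n → y * z ≡±1mod n
  ±1-*         (inj₁ y≡1)  (inj₁ z≡1)  = inj₁ (mod-* y≡1 z≡1)
  ±1-* {y} {z} (inj₁ y≡1)  (inj₂ z≡-1) = inj₂ (mod-trans
    (mod-+ (mod-* y≡1 (mod-refl {a = z})) (mod-refl {a = 1}))
    (subst (λ w → w + 1 ≡ 0 mod n) (sym (*-identityˡ z)) z≡-1))
  ±1-* {y} {z} (inj₂ y≡-1) (inj₁ z≡1)  = inj₂ (mod-trans
    (mod-+ (mod-* (mod-refl {a = y}) z≡1) (mod-refl {a = 1}))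
    (subst (λ w → w + 1 ≡ 0 mod n) (sym (*-identityʳ y)) y≡-1))
  ±1-*         (inj₂ y≡-1) (inj₂ z≡-1) = inj₁ (-1*-1≡1 y≡-1 z≡-1)

  ±1-square : ∀ {y} → y ≡±1mod n → y * y ≡ 1 mod n
  ±1-square (inj₁ y≡1)  = mod-* y≡1 y≡1
  ±1-square (inj₂ y≡-1) = -1*-1≡1 y≡-1 y≡-1

  ±1-resp : ∀ {u v} → u ≡ v mod n → v ≡±1mod n → u ≡±1mod n
  ±1-resp u≡v (inj₁ v≡1)  = inj₁ (mod-trans u≡v v≡1)
  ±1-resp u≡v (inj₂ v≡-1) = inj₂ (mod-trans (mod-+ u≡v (mod-refl {a = 1})) v≡-1)

  ±1-quotient : ∀ {s t} → s * t ≡±1mod n → t ≡±1mod n → s ≡±1mod n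
  ±1-quotient {s} {t} st≡±1 t≡±1 = ±1-resp s≡st*t (±1-* st≡±1 t≡±1)
    where
    s≡st*t : s ≡ s * t * t mod n
    s≡st*t = subst₂ (_≡_mod n) (*-identityʳ s) (sym (*-assoc s t t))
      (mod-* (mod-refl {a = s}) (mod-sym (±1-square t≡±1)))

^-distribʳ-* : ∀ a x k → (a * x) ^ k ≡ a ^ k * x ^ k
^-distribʳ-* a x zero    = refl
^-distribʳ-* a x (suc k) = trans (cong (a * x *_) (^-distribʳ-* a x k)) (interchange a x (a ^ k) (x ^ k))
  where
  interchange : ∀ a x b y → a * x * (b * y) ≡ a * b * (x * y)
  interchange = solve-∀

coprime-*-% : ∀ {n a x} .{{_ : NonZero n}} → Coprime a n → Coprime x n → Coprime ((a * x) % n) n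
coprime-*-% {n} {a} {x} a⊥n x⊥n (d∣ax%n , d∣n) = x⊥n (d∣x , d∣n)
  where
  d⊥a : Coprime _ a
  d⊥a (c∣d , c∣a) = a⊥n (c∣a , ∣-trans c∣d d∣n)
  d∣x = coprime-divisor d⊥a (∣n∣m%n⇒∣m d∣n d∣ax%n)

module _ (n : ℕ) .{{_ : NonZero n}} where

  ∈units⁻ : ∀ {a} → a ∈ units n → a < n × Coprime a n
  ∈units⁻ a∈ with a∈upTo , gcd≡1 ← ∈-filter⁻ (λ a → gcd a n ≟ 1) a∈ =
    ∈-upTo⁻ a∈upTo , gcd≡1⇒coprime gcd≡1

  ∈units⁺ : ∀ {a} → a < n → Coprime a n → a ∈ units n
  ∈units⁺ a<n a⊥n = ∈-filter⁺ (λ a → gcd a n ≟ 1) (∈-upTo⁺ a<n) (coprime⇒gcd≡1 a⊥n)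

  n-1≡-1 : n ∸ 1 + 1 ≡ 0 mod n
  n-1≡-1 = subst (_≡ 0 mod n) (sym (m∸n+n≡m (n≢0⇒n>0 (≢-nonZero⁻¹ n)))) (∣⇒≡0mod ∣-refl)

  %≡±1⇒≡±1 : ∀ {y} → y % n ≡ 1 % n ⊎ y % n ≡ n ∸ 1 → y ≡±1mod n
  %≡±1⇒≡±1     (inj₁ y%n≡1)   = inj₁ (%≡⇒mod y%n≡1)
  %≡±1⇒≡±1 {y} (inj₂ y%n≡n-1) = inj₂ (mod-trans (mod-+ y≡n-1 (mod-refl {a = 1})) n-1≡-1)
    where
    y≡n-1 : y ≡ n ∸ 1 mod n
    y≡n-1 = mod-trans (mod-% y) (≡⇒≡mod y%n≡n-1)

  ≡±1⇒%≡±1 : ∀ {y} → y ≡±1mod n → y % n ≡ 1 % n ⊎ y % n ≡ n ∸ 1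
  ≡±1⇒%≡±1     (inj₁ y≡1)  = inj₁ (mod⇒%≡ y≡1)
  ≡±1⇒%≡±1 {y} (inj₂ y≡-1) = inj₂ (trans (mod⇒%≡ y≡n-1) (m<n⇒m%n≡m n∸1<n))
    where
    n∸1<n : n ∸ 1 < n
    n∸1<n = ∸-monoʳ-< z<s (n≢0⇒n>0 (≢-nonZero⁻¹ n))
    y≡n-1 : y ≡ n ∸ 1 mod n
    y≡n-1 = mod-cancelʳ-+ 1 (mod-trans y≡-1 (mod-sym n-1≡-1))

  private
    e : ℕ
    e = (n ∸ 1) / 2

  InB : ℕ → Set
  InB a = (a ^ e) % n ≡ 1 % n ⊎ (a ^ e) % n ≡ n ∸ 1

  inB? : Decidable InB
  inB? a = ((a ^ e) % n ≟ 1 % n) ⊎-dec ((a ^ e) % n ≟ n ∸ 1)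

  Bᶜ : List ℕ
  Bᶜ = filter (¬? ∘ inB?) (units n)

  ∈B⁻ : ∀ {a} → a ∈ B n → a ∈ units n × InB a
  ∈B⁻ = ∈-filter⁻ inB?

  |Bᶜ|≤|B| : φ n ≤ 2 * length (B n) → length Bᶜ ≤ length (B n)
  |Bᶜ|≤|B| φ≤2|B| = +-cancelˡ-≤ (length (B n)) _ _ (begin
    length (B n) + length Bᶜ  ≡⟨ length-filter-split inB? (units n) ⟩
    φ n                       ≤⟨ φ≤2|B| ⟩
    2 * length (B n)          ≡⟨ cong (length (B n) +_) (+-identityʳ (length (B n))) ⟩
    length (B n) + length (B n) ∎)
    where open ≤-Reasoning

  mul : ℕ → ℕ → ℕ
  mul a x = (a * x) % n

  mul-∈units : ∀ {a x} → a ∈ units n → x ∈ units n → mul a x ∈ units n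
  mul-∈units a∈ x∈ = ∈units⁺ (m%n<n _ n) (coprime-*-% (proj₂ (∈units⁻ a∈)) (proj₂ (∈units⁻ x∈)))

  mul-injective : ∀ {a x y} → Coprime a n → x < n → y < n → mul a x ≡ mul a y → x ≡ y
  mul-injective {a} {x} {y} a⊥n x<n y<n ax≡ay = begin
    x      ≡⟨ m<n⇒m%n≡m x<n ⟨
    x % n  ≡⟨ mod⇒%≡ (mod-cancelˡ-* (Coprime.sym a⊥n) (%≡⇒mod ax≡ay)) ⟩
    y % n  ≡⟨ m<n⇒m%n≡m y<n ⟩
    y      ∎
    where open ≡-Reasoning

  mul-^ : ∀ a x k → mul a x ^ k ≡ a ^ k * x ^ k mod n
  mul-^ a x k = subst (mul a x ^ k ≡_mod n) (^-distribʳ-* a x k) (mod-^ k (mod-sym (mod-% (a * x))))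

  -- If a unit a and its square mod n both lie outside B, then x ↦ a·x mod n
  -- injects a ∷ B into Bᶜ: for x ∈ B, a·x ∈ B would put a ≡ (a·x)/x in B.
  a∷B↪Bᶜ : ∀ {a} → a ∈ units n → ¬ InB a → ¬ InB (mul a a) → suc (length (B n)) ≤ length Bᶜ
  a∷B↪Bᶜ {a} a∈units a∉B a²∉B = injection⇒length≤ (mul a) (a ∷ B n) Bᶜ unique into injective
    where
    ax∉B : ∀ {x} → InB x → ¬ InB (mul a x)
    ax∉B {x} x∈B ax∈B = a∉B (≡±1⇒%≡±1 (±1-quotient
      (±1-resp (mod-sym (mul-^ a x e)) (%≡±1⇒≡±1 ax∈B)) (%≡±1⇒≡±1 x∈B)))

    into : ∀ {x} → x ∈ a ∷ B n → mul a x ∈ Bᶜ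
    into (here refl) = ∈-filter⁺ (¬? ∘ inB?) (mul-∈units a∈units a∈units) a²∉B
    into (there x∈) with x∈units , x∈B ← ∈B⁻ x∈ =
      ∈-filter⁺ (¬? ∘ inB?) (mul-∈units a∈units x∈units) (ax∉B x∈B)

    below-n : ∀ {x} → x ∈ a ∷ B n → x < n
    below-n (here refl) = proj₁ (∈units⁻ a∈units)
    below-n (there x∈)  = proj₁ (∈units⁻ (proj₁ (∈B⁻ x∈)))

    injective : ∀ {x y} → x ∈ a ∷ B n → y ∈ a ∷ B n → mul a x ≡ mul a y → x ≡ y
    injective x∈ y∈ = mul-injective (proj₂ (∈units⁻ a∈units)) (below-n x∈) (below-n y∈)

    unique : Unique (a ∷ B n)
    unique = All.tabulate (λ x∈B a≡x → a∉B (subst InB (sym a≡x) (proj₂ (∈B⁻ x∈B))))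
           ∷ Unique.filter⁺ inB? (Unique.filter⁺ (λ a → gcd a n ≟ 1) (Unique.upTo⁺ n))

  -- If φ(n) ≤ 2|B|, every unit a satisfies a^(2e) ≡ ±1 (mod n): either a ∈ B,
  -- or a² mod n ∈ B, or else a∷B↪Bᶜ contradicts the counting hypothesis.
  unit^2e≡±1 : φ n ≤ 2 * length (B n) → ∀ {a} → a ∈ units n → a ^ (e + e) ≡±1mod n
  unit^2e≡±1 φ≤2|B| {a} a∈units with inB? a | inB? (mul a a)
  ... | yes a∈B | _ = inj₁ (subst (_≡ 1 mod n) (sym (^-distribˡ-+-* a e e)) (±1-square (%≡±1⇒≡±1 a∈B)))
  ... | no _ | yes a²∈B = ±1-resp
    (subst (_≡ mul a a ^ e mod n) (sym (^-distribˡ-+-* a e e)) (mod-sym (mul-^ a a e)))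
    (%≡±1⇒≡±1 a²∈B)
  ... | no a∉B | no a²∉B = ⊥-elim (<-irrefl refl (≤-trans (a∷B↪Bᶜ a∈units a∉B a²∉B) (|Bᶜ|≤|B| φ≤2|B|)))

odd⇒n∸1≡e+e : ∀ {n} → 0 < n → ¬ 2 ∣ n → n ∸ 1 ≡ (n ∸ 1) / 2 + (n ∸ 1) / 2
odd⇒n∸1≡e+e {n} 0<n 2∤n with (n ∸ 1) % 2 | m%n<n (n ∸ 1) 2 | m≡m%n+[m/n]*n (n ∸ 1) 2
... | 0 | _ | n-1≡ = trans n-1≡ (trans (*-comm ((n ∸ 1) / 2) 2) (cong ((n ∸ 1) / 2 +_) (+-identityʳ _)))
... | 1 | _ | n-1≡ = ⊥-elim (2∤n (divides (suc ((n ∸ 1) / 2)) (trans (sym (m+[n∸m]≡n 0<n)) (cong suc n-1≡))))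
... | 2+ _ | s≤s (s≤s ()) | _

lemma2p2 : (n : ℕ) → .{{_ : NonZero n}} → ¬ (2 ∣ n) → Composite n →
    φ n ≤ 2 * length (B n) → IsCarmichael n
lemma2p2 n 2∤n n-composite φ≤2|B| = 2∤n , n-composite , a^[n-1]≡1
  where
  1<n : 1 < n
  1<n = nonTrivial⇒n>1 n {{composite⇒nonTrivial n-composite}}

  a^[n-1]≡1 : ∀ a → a ∈ units n → (a ^ (n ∸ 1)) % n ≡ 1 % n
  a^[n-1]≡1 a a∈units
    with subst (λ k → a ^ k ≡±1mod n) (sym (odd⇒n∸1≡e+e (<-trans z<s 1<n) 2∤n)) (unit^2e≡±1 n φ≤2|B| a∈units)
  ... | inj₁ a^[n-1]≡1  = mod⇒%≡ a^[n-1]≡1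
  ... | inj₂ a^[n-1]≡-1 = ⊥-elim (no-minus-one a 1<n 2∤n a^[n-1]≡-1)
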